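{- Let $G$ be an edge-colored graph which is edge-minimal, and let $v\in V(G)$ satisfy $d^{mon}(v)=\Delta^{mon}(G)$. Let $s=d^c(v)$ and index the colors at $v$ as $1,\dots,s$ so that $d_1(v)\geq\cdots\geq d_s(v)$ (so $d_1(v)=d^{mon}(v)$). For $i\in[1,s]$ let $$B_i(v)=d_i(v)\sum_{1\leq j\leq s}\big(d_j(v)-1\big)-d_i(v)\big(d_i(v)-1\big)-\sum_{y\in N_!(v)}d_{c(vy)}(y,N_i(v)),$$ and $B(v)=\sum_{1\leq i\leq s}B_i(v)$. Then $B(v)\geq 0$. Moreover, if $\Delta^{mon}(G)\geq 2$ and $B(v)=0$, then: (a) $N_!(v)=N(v)\setminus N_1(v)$; (b) $d^{mon}(u)=\Delta^{mon}(G)$ for all $u\in N_!(v)$; (c) if $B_1(v)=0$, then every edge of $G$ between $N_1(v)$ and $N_!(v)$ belongs to $RE(v)$.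
   Context: An edge-colored graph is a simple graph $G$ with edge coloring $c$. $d^c(u)$ is the number of distinct colors on edges incident with $u$. For a color $\alpha$, a vertex $u$ and $X\subseteq V(G)$: $N_\alpha(u)=\{w\in N(u):c(uw)=\alpha\}$, $d_\alpha(u)=|N_\alpha(u)|$, $d_\alpha(u,X)=|N_\alpha(u)\cap X|$. $N_!(u)$ is the union of those $N_\alpha(u)$ with $|N_\alpha(u)|=1$. $d^{mon}(u)=\max_\alpha d_\alpha(u)$ and $\Delta^{mon}(G)=\max_u d^{mon}(u)$. $G$ is edge-minimal if for every edge $e$ there is an endpoint $w$ of $e$ with $d^c_{G-e}(w)<d^c_G(w)$. $RE(v)$ is the set of edges $xy$ such that $vxy$ is a rainbow triangle (its three edges have distinct colors). -}

module Defs where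

open import Data.Bool using (Bool; true; false; _∧_; _∨_; not)
open import Data.Nat using (ℕ; zero; suc; _∸_; _*_; _⊔_; _≡ᵇ_)
import Data.Nat as ℕ
open import Data.Integer using (ℤ; +_; _-_; _+_)
open import Data.Fin using (Fin)
import Data.Fin as Fin
open import Data.List using (List; length; filterᵇ; allFin; map; foldr; deduplicateᵇ)
open import Data.Nat.ListAction using (sum)
open import Data.Product using (_×_)
open import Relation.Nullary using (¬_)
open import Relation.Nullary.Decidable using (⌊_⌋)
open import Relation.Binary.PropositionalEquality using (_≡_; _≢_)

-- Finite simple graph on vertex set Fin n, with an edge coloring by
-- natural-number colors.  col u w is the color of the edge uw
-- (only meaningful when adj u w ≡ true).
record ECGraph (n : ℕ) : Set where
  field
    adj       : Fin n → Fin n → Bool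
    col       : Fin n → Fin n → ℕ
    adj-sym   : ∀ u w → adj u w ≡ adj w u
    adj-irr   : ∀ u → adj u u ≡ false
    col-sym   : ∀ u w → adj u w ≡ true → col u w ≡ col w u
open ECGraph public

countV : ∀ {n} → (Fin n → Bool) → ℕ
countV {n} p = length (filterᵇ p (allFin n))

_==F_ : ∀ {n} → Fin n → Fin n → Bool
x ==F y = ⌊ x Fin.≟ y ⌋

nbrs : ∀ {n} → ECGraph n → Fin n → List (Fin n)
nbrs {n} G u = filterᵇ (adj G u) (allFin n)

dcol : ∀ {n} → ECGraph n → Fin n → ℕ → ℕ
dcol G u α = countV (λ w → adj G u w ∧ (col G u w ≡ᵇ α))

colorsAt : ∀ {n} → ECGraph n → Fin n → List ℕ
colorsAt G u = deduplicateᵇ _≡ᵇ_ (map (col G u) (nbrs G u))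

dc : ∀ {n} → ECGraph n → Fin n → ℕ
dc G u = length (colorsAt G u)

dmon : ∀ {n} → ECGraph n → Fin n → ℕ
dmon G u = foldr _⊔_ 0 (map (dcol G u) (colorsAt G u))

Δmon : ∀ {n} → ECGraph n → ℕ
Δmon {n} G = foldr _⊔_ 0 (map (dmon G) (allFin n))

removeEdge : ∀ {n} → (G : ECGraph n) → (u w : Fin n) → ECGraph n
removeEdge G u w = record
  { adj = λ x y → adj G x y ∧ not ((x ==F u ∧ y ==F w) ∨ (x ==F w ∧ y ==F u))
  ; col = col G
  ; adj-sym = sym′
  ; adj-irr = irr′
  ; col-sym = cs′
  }
  where
  open import Relation.Binary.PropositionalEquality using (refl; cong₂)
  open import Data.Bool.Properties using (∧-comm; ∨-comm)
  sym′ : ∀ x y → (adj G x y ∧ not ((x ==F u ∧ y ==F w) ∨ (x ==F w ∧ y ==F u)))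
                ≡ (adj G y x ∧ not ((y ==F u ∧ x ==F w) ∨ (y ==F w ∧ x ==F u)))
  sym′ x y rewrite adj-sym G x y | ∧-comm (x ==F u) (y ==F w) | ∧-comm (x ==F w) (y ==F u)
                 | ∨-comm (y ==F w ∧ x ==F u) (y ==F u ∧ x ==F w) = refl
  irr′ : ∀ x → (adj G x x ∧ not ((x ==F u ∧ x ==F w) ∨ (x ==F w ∧ x ==F u))) ≡ false
  irr′ x rewrite adj-irr G x = refl
  cs′ : ∀ x y → (adj G x y ∧ not ((x ==F u ∧ y ==F w) ∨ (x ==F w ∧ y ==F u))) ≡ true
        → col G x y ≡ col G y x
  cs′ x y h with adj G x y in eq
  ... | true = col-sym G x y eq
  cs′ x y () | false

EdgeMinimal : ∀ {n} → ECGraph n → Set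
EdgeMinimal {n} G = ∀ (u w : Fin n) → adj G u w ≡ true →
  (dc (removeEdge G u w) u ℕ.< dc G u) Data.Sum.⊎ (dc (removeEdge G u w) w ℕ.< dc G w)
  where import Data.Sum

InN : ∀ {n} → ECGraph n → Fin n → Fin n → Set
InN G v y = adj G v y ≡ true

InNα : ∀ {n} → ECGraph n → ℕ → Fin n → Fin n → Set
InNα G α v y = adj G v y ≡ true × col G v y ≡ α

InN! : ∀ {n} → ECGraph n → Fin n → Fin n → Set
InN! G v y = adj G v y ≡ true × dcol G v (col G v y) ≡ 1

isN! : ∀ {n} → ECGraph n → Fin n → Fin n → Bool
isN! G v y = adj G v y ∧ (dcol G v (col G v y) ≡ᵇ 1)

dcolIn : ∀ {n} → ECGraph n → Fin n → ℕ → ℕ → Fin n → ℕ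
dcolIn G u α i v = countV (λ w → adj G u w ∧ (col G u w ≡ᵇ α) ∧ adj G v w ∧ (col G v w ≡ᵇ i))

sumℤ : List ℤ → ℤ
sumℤ = foldr _+_ (+ 0)

Bi : ∀ {n} → ECGraph n → Fin n → ℕ → ℤ
Bi {n} G v i =
  (+ (dcol G v i * sum (map (λ j → dcol G v j ∸ 1) (colorsAt G v))))
  - (+ (dcol G v i * (dcol G v i ∸ 1)))
  - (+ sum (map (λ y → dcolIn G y (col G v y) i v) (filterᵇ (isN! G v) (allFin n))))

B : ∀ {n} → ECGraph n → Fin n → ℤ
B G v = sumℤ (map (Bi G v) (colorsAt G v))

InRE : ∀ {n} → ECGraph n → Fin n → Fin n → Fin n → Set
InRE G v x y =
  adj G v x ≡ true × adj G v y ≡ true × adj G x y ≡ true ×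
  col G v x ≢ col G v y × col G v x ≢ col G x y × col G v y ≢ col G x y

-- Write d_i = d_i(v), T = Σ_j (d_j − 1) (called excess below), D = Δ^mon − 1 and
-- e(y) = Σ_i d_{c(vy)}(y, N_i(v)). Exchanging the order of summation,
-- B(v) = Σ_i (P i − Q i) − Σ_{y ∈ N_!(v)} e(y) with P i = d_i T and Q i = d_i (d_i − 1).
-- As v is a c(vy)-neighbour of y outside N(v), e(y) ≤ d_{c(vy)}(y) − 1 ≤ D, and N_!(v) has
-- at most one vertex per colour i with d_i = 1. Charging D to each such colour, every colour
-- satisfies Q i + [d_i = 1] D ≤ P i (because T ≥ d^mon(v) − 1 = D), and summing gives B(v) ≥ 0.
-- If B(v) = 0 all these inequalities are tight. At α₁, where d_{α₁} = Δ^mon ≥ 2, this forces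
-- T = d_{α₁} − 1, so every other colour at v is a singleton: (a). Tightness of e(u) ≤ D gives
-- d^mon(u) ≥ D + 1 = Δ^mon: (b). For (c), B_{α₁}(v) = 0 now says that no y ∈ N_!(v) has a
-- neighbour x ∈ N_{α₁}(v) with c(xy) = c(vy); and c(vx) = c(xy) contradicts edge-minimality,
-- since deleting vx keeps α₁ at v (d_{α₁} ≥ 2) and keeps c(vx) at x.

module Submission where

open import Defs
open import Data.Nat using (ℕ; _≤_)
open import Data.Fin using (Fin)
open import Data.Bool using (true)
open import Data.Integer using (+_)
import Data.Integer as ℤ
open import Data.Product using (_×_)
open import Relation.Binary.PropositionalEquality using (_≡_; _≢_)

open import Data.Nat using (zero; suc; >-nonZero; _+_; _*_; _∸_; _⊔_; _≡ᵇ_; _<_; z≤n; s≤s)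
open import Data.Nat.Properties
open import Data.Nat.ListAction using (sum)
open import Data.Bool using (Bool; false; T?; _∧_)
open import Data.Bool.Properties using (T-≡; ∧-conical; ∧-zeroʳ)
import Data.Fin as Fin
open import Data.List using (List; []; _∷_; map; filterᵇ; length; foldr; allFin; deduplicateᵇ)
open import Data.List.Membership.Propositional using (_∈_)
open import Data.List.Membership.Propositional.Properties
  using (∈-map⁺; ∈-map⁻; ∈-filter⁺; ∈-filter⁻; ∈-allFin)
open import Data.List.Relation.Unary.Any using (here; there)
import Data.List.Relation.Unary.Any.Properties as Any
open import Data.List.Relation.Unary.All as All using (All; []; _∷_)
import Data.List.Relation.Unary.All.Properties as All
open import Data.List.Relation.Unary.AllPairs using ([]; _∷_)
open import Data.List.Relation.Unary.Unique.Propositional using (Unique)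
import Data.List.Relation.Unary.Unique.Propositional.Properties as Unique
open import Data.Product using (∃; _,_; proj₁; proj₂)
open import Data.Sum using (_⊎_; inj₁; inj₂)
open import Data.Empty using (⊥-elim)
open import Function using (_∘_; Equivalence)
open import Relation.Binary.Definitions using (DecidableEquality)
open import Relation.Binary.PropositionalEquality
  using (refl; sym; trans; cong; cong₂; subst; subst₂; module ≡-Reasoning)
open import Relation.Nullary using (yes; no; ¬?)
open import Relation.Nullary.Decidable using (isYes≗does; dec-false)
open import Data.Nat.Tactic.RingSolver using (solve-∀)
import Data.Integer.Properties as ℤ
import Data.Integer.Tactic.RingSolver as ℤ-Solver

∧≡true⁻ : ∀ {a b} → (a ∧ b) ≡ true → a ≡ true × b ≡ true
∧≡true⁻ {a} {b} a∧b = proj₁ ∧-conical a b a∧b , proj₂ ∧-conical a b a∧b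

≡ᵇ-refl : ∀ a → (a ≡ᵇ a) ≡ true
≡ᵇ-refl a = Equivalence.to T-≡ (≡⇒≡ᵇ a a refl)

≡ᵇ≡true⇒≡ : ∀ {a b} → (a ≡ᵇ b) ≡ true → a ≡ b
≡ᵇ≡true⇒≡ {a} {b} a≡ᵇb = ≡ᵇ⇒≡ a b (Equivalence.from T-≡ a≡ᵇb)

≢⇒≡ᵇ-false : ∀ {a b} → a ≢ b → (a ≡ᵇ b) ≡ false
≢⇒≡ᵇ-false {a} {b} a≢b with a ≡ᵇ b in a≡ᵇb
... | false = refl
... | true  = ⊥-elim (a≢b (≡ᵇ≡true⇒≡ a≡ᵇb))

≢⇒==F-false : ∀ {n} {x y : Fin n} → x ≢ y → (x ==F y) ≡ false
≢⇒==F-false {x = x} {y} x≢y = trans (isYes≗does (x Fin.≟ y)) (dec-false (x Fin.≟ y) x≢y)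

∑ : {A : Set} → List A → (A → ℕ) → ℕ
∑ xs f = sum (map f xs)

ind : Bool → ℕ
ind true  = 1
ind false = 0

module _ {A : Set} where

  ∑-cong : ∀ (xs : List A) f g → (∀ x → f x ≡ g x) → ∑ xs f ≡ ∑ xs g
  ∑-cong []       f g f≡g = refl
  ∑-cong (x ∷ xs) f g f≡g = cong₂ _+_ (f≡g x) (∑-cong xs f g f≡g)

  ∑-zeros : ∀ (xs : List A) → ∑ xs (λ _ → 0) ≡ 0
  ∑-zeros []       = refl
  ∑-zeros (x ∷ xs) = ∑-zeros xs

  ∑-+ : ∀ (xs : List A) f g → ∑ xs (λ x → f x + g x) ≡ ∑ xs f + ∑ xs g
  ∑-+ []       f g = refl
  ∑-+ (x ∷ xs) f g rewrite ∑-+ xs f g = exchange (f x) (g x) (∑ xs f) (∑ xs g)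
    where
    exchange : ∀ a b c d → a + b + (c + d) ≡ a + c + (b + d)
    exchange = solve-∀

  ∑-*ʳ : ∀ (xs : List A) f k → ∑ xs (λ x → f x * k) ≡ ∑ xs f * k
  ∑-*ʳ []       f k = refl
  ∑-*ʳ (x ∷ xs) f k rewrite ∑-*ʳ xs f k = sym (*-distribʳ-+ k (f x) (∑ xs f))

  ∑-const : ∀ (xs : List A) k → ∑ xs (λ _ → k) ≡ length xs * k
  ∑-const []       k = refl
  ∑-const (x ∷ xs) k = cong (_+_ k) (∑-const xs k)

  ∑-mono-≤ : ∀ (xs : List A) f g → (∀ x → x ∈ xs → f x ≤ g x) → ∑ xs f ≤ ∑ xs g
  ∑-mono-≤ []       f g f≤g = z≤n
  ∑-mono-≤ (x ∷ xs) f g f≤g =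
    +-mono-≤ (f≤g x (here refl)) (∑-mono-≤ xs f g (λ y y∈ → f≤g y (there y∈)))

  ∑-mono-< : ∀ (xs : List A) f g → (∀ x → x ∈ xs → f x ≤ g x) →
             ∀ x → x ∈ xs → f x < g x → ∑ xs f < ∑ xs g
  ∑-mono-< (y ∷ xs) f g f≤g x (here refl) fx<gx =
    +-mono-<-≤ fx<gx (∑-mono-≤ xs f g (λ z z∈ → f≤g z (there z∈)))
  ∑-mono-< (y ∷ xs) f g f≤g x (there x∈) fx<gx =
    +-mono-≤-< (f≤g y (here refl)) (∑-mono-< xs f g (λ z z∈ → f≤g z (there z∈)) x x∈ fx<gx)

  term≤∑ : ∀ (xs : List A) f x → x ∈ xs → f x ≤ ∑ xs f
  term≤∑ (y ∷ xs) f x (here refl) = m≤m+n (f x) _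
  term≤∑ (y ∷ xs) f x (there x∈) = ≤-trans (term≤∑ xs f x x∈) (m≤n+m _ (f y))

  ∑≡0⇒term≡0 : ∀ (xs : List A) f → ∑ xs f ≡ 0 → ∀ x → x ∈ xs → f x ≡ 0
  ∑≡0⇒term≡0 xs f ∑≡0 x x∈ = n≤0⇒n≡0 (subst (f x ≤_) ∑≡0 (term≤∑ xs f x x∈))

  ∑-all-zero : ∀ (xs : List A) f → All (λ x → f x ≡ 0) xs → ∑ xs f ≡ 0
  ∑-all-zero []       f []            = refl
  ∑-all-zero (x ∷ xs) f (fx≡0 ∷ rest) rewrite fx≡0 = ∑-all-zero xs f rest

  ∑-mono-≤-tight : ∀ (xs : List A) f g → (∀ x → x ∈ xs → f x ≤ g x) → ∑ xs g ≤ ∑ xs f →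
                   ∀ x → x ∈ xs → f x ≡ g x
  ∑-mono-≤-tight (y ∷ xs) f g f≤g ∑g≤∑f = tight
    where
    f≤g-tail : ∀ x → x ∈ xs → f x ≤ g x
    f≤g-tail x x∈ = f≤g x (there x∈)
    gy≤fy : g y ≤ f y
    gy≤fy with g y ≤? f y
    ... | yes gy≤fy = gy≤fy
    ... | no  gy≰fy = ⊥-elim (<⇒≱ (+-mono-<-≤ (≰⇒> gy≰fy) (∑-mono-≤ xs f g f≤g-tail)) ∑g≤∑f)
    tail≤ : ∑ xs g ≤ ∑ xs f
    tail≤ = +-cancelˡ-≤ (f y) _ _ (≤-trans (+-monoˡ-≤ (∑ xs g) (f≤g y (here refl))) ∑g≤∑f)
    tight : ∀ x → x ∈ y ∷ xs → f x ≡ g x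
    tight x (here refl) = ≤-antisym (f≤g y (here refl)) gy≤fy
    tight x (there x∈)  = ∑-mono-≤-tight xs f g f≤g-tail tail≤ x x∈

  length-filterᵇ : ∀ (p : A → Bool) xs → length (filterᵇ p xs) ≡ ∑ xs (ind ∘ p)
  length-filterᵇ p [] = refl
  length-filterᵇ p (x ∷ xs) with p x
  ... | true  = cong suc (length-filterᵇ p xs)
  ... | false = length-filterᵇ p xs

  filterᵇ-witness : ∀ (p : A → Bool) xs → 1 ≤ length (filterᵇ p xs) →
                    ∃ λ x → x ∈ xs × p x ≡ true
  filterᵇ-witness p (x ∷ xs) 1≤ with p x in px
  ... | true  = x , here refl , px
  ... | false with filterᵇ-witness p xs 1≤
  ...   | y , y∈ , py = y , there y∈ , py

∑-swap : ∀ {A B : Set} (xs : List A) (ys : List B) (f : A → B → ℕ) →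
         ∑ xs (λ x → ∑ ys (f x)) ≡ ∑ ys (λ y → ∑ xs (λ x → f x y))
∑-swap []       ys f = sym (∑-zeros ys)
∑-swap (x ∷ xs) ys f rewrite ∑-swap xs ys f = sym (∑-+ ys (f x) (λ y → ∑ xs (λ x → f x y)))

term≤max : ∀ {A : Set} (xs : List A) f x → x ∈ xs → f x ≤ foldr _⊔_ 0 (map f xs)
term≤max (y ∷ xs) f x (here refl) = m≤m⊔n (f x) _
term≤max (y ∷ xs) f x (there x∈) = ≤-trans (term≤max xs f x x∈) (m≤n⊔m (f y) _)

max∸1≤∑∸1 : ∀ {A : Set} (xs : List A) f → foldr _⊔_ 0 (map f xs) ∸ 1 ≤ ∑ xs (λ x → f x ∸ 1)
max∸1≤∑∸1 []       f = z≤n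
max∸1≤∑∸1 (x ∷ xs) f = step (f x) (foldr _⊔_ 0 (map f xs)) (max∸1≤∑∸1 xs f)
  where
  step : ∀ a m → m ∸ 1 ≤ ∑ xs (λ x → f x ∸ 1) → (a ⊔ m) ∸ 1 ≤ (a ∸ 1) + ∑ xs (λ x → f x ∸ 1)
  step zero    m       m≤ = m≤
  step (suc a) zero    m≤ = m≤m+n a _
  step (suc a) (suc m) m≤ = ≤-trans (m⊔n≤m+n a m) (+-monoʳ-≤ a m≤)

deduplicateᵇ-unique : ∀ xs → Unique (deduplicateᵇ _≡ᵇ_ xs)
deduplicateᵇ-unique []       = []
deduplicateᵇ-unique (x ∷ xs) =
  All.map (λ {y} x≢ᵇy x≡y → x≢ᵇy (≡⇒≡ᵇ x y x≡y)) (All.all-filter x≢ᵇ? rest)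
    ∷ Unique.filter⁺ x≢ᵇ? (deduplicateᵇ-unique xs)
  where
  rest = deduplicateᵇ _≡ᵇ_ xs
  x≢ᵇ? = λ y → ¬? (T? (x ≡ᵇ y))

∈-deduplicateᵇ⁺ : ∀ {x} xs → x ∈ xs → x ∈ deduplicateᵇ _≡ᵇ_ xs
∈-deduplicateᵇ⁺ xs = Any.deduplicate⁺ _ (λ {y} {z} z≡ᵇy x≡y → trans x≡y (sym (≡ᵇ⇒≡ z y z≡ᵇy)))

∈-deduplicateᵇ⁻ : ∀ {x} xs → x ∈ deduplicateᵇ _≡ᵇ_ xs → x ∈ xs
∈-deduplicateᵇ⁻ xs = Any.deduplicate⁻ _

∑-ind-≡ᵇ≤1 : ∀ (xs : List ℕ) → Unique xs → ∀ x → ∑ xs (λ i → ind (x ≡ᵇ i)) ≤ 1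
∑-ind-≡ᵇ≤1 []       []            x = z≤n
∑-ind-≡ᵇ≤1 (y ∷ xs) (y∉xs ∷ xs!) x with x ≡ᵇ y in x≡ᵇy
... | false = ∑-ind-≡ᵇ≤1 xs xs! x
... | true = ≤-reflexive (cong suc (∑-all-zero xs _ (All.map x≢ᵇ y∉xs)))
  where
  x≢ᵇ : ∀ {i} → y ≢ i → ind (x ≡ᵇ i) ≡ 0
  x≢ᵇ y≢i = cong ind (≢⇒≡ᵇ-false {x} (λ x≡i → y≢i (trans (sym (≡ᵇ≡true⇒≡ {x} {y} x≡ᵇy)) x≡i)))

two-terms≤∑ : ∀ {A : Set} (xs : List A) → Unique xs →
              ∀ f a b → a ∈ xs → b ∈ xs → a ≢ b → f a + f b ≤ ∑ xs f
two-terms≤∑ (y ∷ xs) xs! f a b (here refl) (here refl) a≢b = ⊥-elim (a≢b refl)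
two-terms≤∑ (y ∷ xs) xs! f a b (here refl) (there b∈) a≢b = +-monoʳ-≤ (f a) (term≤∑ xs f b b∈)
two-terms≤∑ (y ∷ xs) xs! f a b (there a∈) (here refl) a≢b =
  subst (_≤ f b + ∑ xs f) (+-comm (f b) (f a)) (+-monoʳ-≤ (f b) (term≤∑ xs f a a∈))
two-terms≤∑ (y ∷ xs) (_ ∷ xs!) f a b (there a∈) (there b∈) a≢b =
  ≤-trans (two-terms≤∑ xs xs! f a b a∈ b∈ a≢b) (m≤n+m _ (f y))

-- double counting the pairs (x, y) ∈ xs × ys with x ≡ y
unique-⊆⇒length≤ : ∀ (xs ys : List ℕ) → Unique xs → (∀ x → x ∈ xs → x ∈ ys) → length xs ≤ length ys
unique-⊆⇒length≤ xs ys xs! xs⊆ys = begin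
  length xs                                ≡⟨ trans (∑-const xs 1) (*-identityʳ _) ⟨
  ∑ xs (λ _ → 1)                           ≤⟨ ∑-mono-≤ xs _ _ hit ⟩
  ∑ xs (λ x → ∑ ys (λ y → ind (y ≡ᵇ x)))   ≡⟨ ∑-swap xs ys _ ⟩
  ∑ ys (λ y → ∑ xs (λ x → ind (y ≡ᵇ x)))   ≤⟨ ∑-mono-≤ ys _ _ (λ y _ → ∑-ind-≡ᵇ≤1 xs xs! y) ⟩
  ∑ ys (λ _ → 1)                           ≡⟨ trans (∑-const ys 1) (*-identityʳ _) ⟩
  length ys                                ∎
  where
  open ≤-Reasoning
  hit : ∀ x → x ∈ xs → 1 ≤ ∑ ys (λ y → ind (y ≡ᵇ x))
  hit x x∈ = subst (_≤ ∑ ys (λ y → ind (y ≡ᵇ x))) (cong ind (≡ᵇ-refl x))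
                   (term≤∑ ys (λ y → ind (y ≡ᵇ x)) x (xs⊆ys x x∈))

filterᵇ-witness-≢ : ∀ {A : Set} → DecidableEquality A → ∀ (p : A → Bool) xs → Unique xs →
                    2 ≤ length (filterᵇ p xs) → ∀ z → ∃ λ x → x ≢ z × p x ≡ true
filterᵇ-witness-≢ _≟_ p (x ∷ xs) (x∉xs ∷ xs!) 2≤ z with p x in px
... | false = filterᵇ-witness-≢ _≟_ p xs xs! 2≤ z
filterᵇ-witness-≢ _≟_ p (x ∷ xs) (x∉xs ∷ xs!) (s≤s 1≤) z | true with x ≟ z
... | no x≢z = x , x≢z , px
... | yes refl with filterᵇ-witness p xs 1≤
...   | y , y∈ , py = y , (λ y≡x → All.lookup x∉xs y∈ (sym y≡x)) , py

c-a-b≡c-[a+b] : ∀ a b c → + c ℤ.- + a ℤ.- + b ≡ + c ℤ.- + (a + b)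
c-a-b≡c-[a+b] a b c rewrite ℤ.pos-+ a b = reassoc (+ a) (+ b) (+ c)
  where
  reassoc : ∀ p q r → r ℤ.- p ℤ.- q ≡ r ℤ.- (p ℤ.+ q)
  reassoc = ℤ-Solver.solve-∀

c-a-b≡0⇒a+b≡c : ∀ a b c → + c ℤ.- + a ℤ.- + b ≡ + 0 → a + b ≡ c
c-a-b≡0⇒a+b≡c a b c c-a-b≡0 =
  sym (ℤ.+-injective (ℤ.i-j≡0⇒i≡j _ _ (trans (sym (c-a-b≡c-[a+b] a b c)) c-a-b≡0)))

a+b≤c⇒0≤c-a-b : ∀ a b c → a + b ≤ c → + 0 ℤ.≤ + c ℤ.- + a ℤ.- + b
a+b≤c⇒0≤c-a-b a b c a+b≤c = subst (+ 0 ℤ.≤_) (sym c-a-b≡c∸[a+b]) (ℤ.+≤+ z≤n)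
  where
  c-a-b≡c∸[a+b] : + c ℤ.- + a ℤ.- + b ≡ + (c ∸ (a + b))
  c-a-b≡c∸[a+b] = trans (c-a-b≡c-[a+b] a b c) (trans (ℤ.m-n≡m⊖n c (a + b)) (ℤ.⊖-≥ a+b≤c))

sumℤ-map-a-b-c : ∀ {A : Set} (xs : List A) (f g h : A → ℕ) →
  sumℤ (map (λ x → + f x ℤ.- + g x ℤ.- + h x) xs) ≡ + ∑ xs f ℤ.- + ∑ xs g ℤ.- + ∑ xs h
sumℤ-map-a-b-c []       f g h = refl
sumℤ-map-a-b-c (x ∷ xs) f g h
  rewrite sumℤ-map-a-b-c xs f g h
        | ℤ.pos-+ (f x) (∑ xs f) | ℤ.pos-+ (g x) (∑ xs g) | ℤ.pos-+ (h x) (∑ xs h) =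
  regroup (+ f x) (+ g x) (+ h x) (+ ∑ xs f) (+ ∑ xs g) (+ ∑ xs h)
  where
  regroup : ∀ p q r s t u → p ℤ.- q ℤ.- r ℤ.+ (s ℤ.- t ℤ.- u) ≡ p ℤ.+ s ℤ.- (q ℤ.+ t) ℤ.- (r ℤ.+ u)
  regroup = ℤ-Solver.solve-∀

module _ {n : ℕ} (G : ECGraph n) where

  countV≡∑ : ∀ (p : Fin n → Bool) → countV p ≡ ∑ (allFin n) (ind ∘ p)
  countV≡∑ p = length-filterᵇ p (allFin n)

  adj⇒≢ : ∀ {u w} → adj G u w ≡ true → w ≢ u
  adj⇒≢ {u} uw refl with trans (sym uw) (adj-irr G u)
  ... | ()

  adj-flip : ∀ {u w} → adj G u w ≡ true → adj G w u ≡ true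
  adj-flip {u} {w} uw = trans (adj-sym G w u) uw

  col∈colorsAt : ∀ {u w} → adj G u w ≡ true → col G u w ∈ colorsAt G u
  col∈colorsAt {u} {w} uw = ∈-deduplicateᵇ⁺ _
    (∈-map⁺ (col G u) (∈-filter⁺ (T? ∘ adj G u) (∈-allFin w) (Equivalence.from T-≡ uw)))

  colorsAt⇒edge : ∀ {u c} → c ∈ colorsAt G u → ∃ λ w → adj G u w ≡ true × col G u w ≡ c
  colorsAt⇒edge {u} c∈ with ∈-map⁻ (col G u) (∈-deduplicateᵇ⁻ _ c∈)
  ... | w , w∈ , c≡ =
    w , Equivalence.to T-≡ (proj₂ (∈-filter⁻ (T? ∘ adj G u) {xs = allFin n} w∈)) , sym c≡

  colorsAt-unique : ∀ u → Unique (colorsAt G u)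
  colorsAt-unique u = deduplicateᵇ-unique _

  dcol≤dmon : ∀ {u c} → c ∈ colorsAt G u → dcol G u c ≤ dmon G u
  dcol≤dmon {u} = term≤max (colorsAt G u) (dcol G u) _

  dmon≤Δmon : ∀ u → dmon G u ≤ Δmon G
  dmon≤Δmon u = term≤max (allFin n) (dmon G) u (∈-allFin u)

  dcol-col-flip≤dmon : ∀ {v y} → adj G v y ≡ true → dcol G y (col G v y) ≤ dmon G y
  dcol-col-flip≤dmon {v} {y} vy =
    subst (λ c → dcol G y c ≤ dmon G y) (sym (col-sym G v y vy))
          (dcol≤dmon (col∈colorsAt (adj-flip vy)))

  countV-witness : ∀ (p : Fin n → Bool) {w} → p w ≡ true → 1 ≤ countV p
  countV-witness p {w} pw =
    subst₂ _≤_ (cong ind pw) (sym (countV≡∑ p)) (term≤∑ (allFin n) (ind ∘ p) w (∈-allFin w))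

  adj⇒1≤dcol : ∀ {u w} → adj G u w ≡ true → 1 ≤ dcol G u (col G u w)
  adj⇒1≤dcol {u} {w} uw = countV-witness _ uw-counted
    where
    uw-counted : (adj G u w ∧ (col G u w ≡ᵇ col G u w)) ≡ true
    uw-counted rewrite uw = ≡ᵇ-refl (col G u w)

  1≤dcol⇒∈colorsAt : ∀ {u c} → 1 ≤ dcol G u c → c ∈ colorsAt G u
  1≤dcol⇒∈colorsAt {u} {c} 1≤ with filterᵇ-witness _ (allFin n) 1≤
  ... | w , _ , uw-c with ∧≡true⁻ uw-c
  ...   | uw , c≡ = subst (_∈ colorsAt G u) (≡ᵇ≡true⇒≡ c≡) (col∈colorsAt uw)

  2≤dcol⇒another-edge : ∀ {u c} → 2 ≤ dcol G u c → ∀ z →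
                        ∃ λ w → w ≢ z × adj G u w ≡ true × col G u w ≡ c
  2≤dcol⇒another-edge {u} {c} 2≤ z
    with filterᵇ-witness-≢ Fin._≟_ _ (allFin n) (Unique.allFin⁺ n) 2≤ z
  ... | w , w≢z , uw-c with ∧≡true⁻ uw-c
  ...   | uw , c≡ = w , w≢z , uw , ≡ᵇ≡true⇒≡ c≡

module _ {n : ℕ} (G : ECGraph n) where

  removeEdge-adj : ∀ {a b u w} → w ≢ a → w ≢ b →
                   adj G u w ≡ true → adj (removeEdge G a b) u w ≡ true
  removeEdge-adj {a} {b} {u} {w} w≢a w≢b uw
    rewrite uw | ≢⇒==F-false w≢a | ≢⇒==F-false w≢b | ∧-zeroʳ (u ==F a) | ∧-zeroʳ (u ==F b) = refl

  removeEdge-adj-other : ∀ {a b u z w} → (u ≡ a × z ≡ b) ⊎ (u ≡ b × z ≡ a) →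
                         adj G u w ≡ true → w ≢ z → adj (removeEdge G a b) u w ≡ true
  removeEdge-adj-other (inj₁ (refl , refl)) uw w≢z = removeEdge-adj (adj⇒≢ G uw) w≢z uw
  removeEdge-adj-other (inj₂ (refl , refl)) uw w≢z = removeEdge-adj w≢z (adj⇒≢ G uw) uw

  -- the disjunction says that uz is the deleted edge ab, in either orientation
  dc≤dc-removeEdge : ∀ {a b u z z′} → (u ≡ a × z ≡ b) ⊎ (u ≡ b × z ≡ a) →
                     adj G u z′ ≡ true → z′ ≢ z → col G u z′ ≡ col G u z →
                     dc G u ≤ dc (removeEdge G a b) u
  dc≤dc-removeEdge {a} {b} {u} {z} {z′} uz≡ab uz′ z′≢z z′-col =
    unique-⊆⇒length≤ (colorsAt G u) (colorsAt G′ u) (colorsAt-unique G u) survives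
    where
    G′ = removeEdge G a b
    survives : ∀ c → c ∈ colorsAt G u → c ∈ colorsAt G′ u
    survives c c∈ with colorsAt⇒edge G c∈
    ... | w , uw , refl with w Fin.≟ z
    ...   | no w≢z  = col∈colorsAt G′ (removeEdge-adj-other uz≡ab uw w≢z)
    ...   | yes refl =
      subst (_∈ colorsAt G′ u) z′-col (col∈colorsAt G′ (removeEdge-adj-other uz≡ab uz′ z′≢z))

-- The charging argument at a vertex of maximum monochromatic degree

module Charging {n : ℕ} (G : ECGraph n) (v : Fin n) (v-max : dmon G v ≡ Δmon G) where

  V : List (Fin n)
  V = allFin n

  C : List ℕ
  C = colorsAt G v

  d : ℕ → ℕ
  d = dcol G v

  N! : List (Fin n)
  N! = filterᵇ (isN! G v) V

  D : ℕ
  D = dmon G v ∸ 1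

  excess : ℕ
  excess = ∑ C (λ j → d j ∸ 1)

  P Q S charge : ℕ → ℕ
  P i = d i * excess
  Q i = d i * (d i ∸ 1)
  S i = ∑ N! (λ y → dcolIn G y (col G v y) i v)
  charge i = ind (d i ≡ᵇ 1) * D

  e : Fin n → ℕ
  e y = ∑ C (λ i → dcolIn G y (col G v y) i v)

  B≡P-Q-S : B G v ≡ + ∑ C P ℤ.- + ∑ C Q ℤ.- + ∑ C S
  B≡P-Q-S = sumℤ-map-a-b-c C P Q S

  ∑S≡∑e : ∑ C S ≡ ∑ N! e
  ∑S≡∑e = ∑-swap C N! (λ i y → dcolIn G y (col G v y) i v)

  ∈N!⇒adj : ∀ {y} → y ∈ N! → adj G v y ≡ true
  ∈N!⇒adj y∈ = proj₁ (∧≡true⁻ (Equivalence.to T-≡ (proj₂ (∈-filter⁻ (T? ∘ isN! G v) {xs = V} y∈))))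

  InN!⇒∈N! : ∀ {y} → InN! G v y → y ∈ N!
  InN!⇒∈N! {y} (vy , dy≡1) = ∈-filter⁺ (T? ∘ isN! G v) (∈-allFin y) (Equivalence.from T-≡ y-counted)
    where
    y-counted : isN! G v y ≡ true
    y-counted rewrite vy | dy≡1 = refl

  e<dcol : ∀ {y} → adj G v y ≡ true → e y < dcol G y (col G v y)
  e<dcol {y} vy = begin-strict
    e y
      ≡⟨ ∑-cong C _ _ (λ i → countV≡∑ G _) ⟩
    ∑ C (λ i → ∑ V (λ w → ind (adj G y w ∧ (col G y w ≡ᵇ cy) ∧ adj G v w ∧ (col G v w ≡ᵇ i))))
      ≡⟨ ∑-swap C V _ ⟩
    ∑ V (λ w → ∑ C (λ i → ind (adj G y w ∧ (col G y w ≡ᵇ cy) ∧ adj G v w ∧ (col G v w ≡ᵇ i))))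
      ≤⟨ ∑-mono-≤ V _ _ (λ w _ → one-colour (adj G y w) (col G y w ≡ᵇ cy) (adj G v w) (col G v w)) ⟩
    ∑ V (λ w → ind (adj G y w ∧ (col G y w ≡ᵇ cy) ∧ adj G v w))
      <⟨ ∑-mono-< V _ _ (λ w _ → drop-conjunct (adj G y w) (col G y w ≡ᵇ cy) (adj G v w))
                      v (∈-allFin v) v-not-in-N[v] ⟩
    ∑ V (λ w → ind (adj G y w ∧ (col G y w ≡ᵇ cy)))
      ≡⟨ countV≡∑ G _ ⟨
    dcol G y cy ∎
    where
    open ≤-Reasoning
    cy = col G v y
    one-colour : ∀ p q r c → ∑ C (λ i → ind (p ∧ q ∧ r ∧ (c ≡ᵇ i))) ≤ ind (p ∧ q ∧ r)
    one-colour true  true  true  c = ∑-ind-≡ᵇ≤1 C (colorsAt-unique G v) c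
    one-colour true  true  false c = ≤-reflexive (∑-zeros C)
    one-colour true  false r     c = ≤-reflexive (∑-zeros C)
    one-colour false q     r     c = ≤-reflexive (∑-zeros C)
    drop-conjunct : ∀ p q r → ind (p ∧ q ∧ r) ≤ ind (p ∧ q)
    drop-conjunct true  true  true  = ≤-refl
    drop-conjunct true  true  false = z≤n
    drop-conjunct true  false r     = z≤n
    drop-conjunct false q     r     = z≤n
    v-not-in-N[v] : ind (adj G y v ∧ (col G y v ≡ᵇ cy) ∧ adj G v v)
                  < ind (adj G y v ∧ (col G y v ≡ᵇ cy))
    v-not-in-N[v]
      rewrite adj-flip G vy | sym (col-sym G v y vy) | ≡ᵇ-refl cy | adj-irr G v = s≤s z≤n

  e≤D : ∀ {y} → adj G v y ≡ true → e y ≤ D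
  e≤D {y} vy = <⇒≤pred (≤-trans (e<dcol vy) (≤-trans (dcol-col-flip≤dmon G vy) dmon-y≤dmon-v))
    where
    dmon-y≤dmon-v : dmon G y ≤ dmon G v
    dmon-y≤dmon-v = subst (dmon G y ≤_) (sym v-max) (dmon≤Δmon G y)

  -- each y ∈ N! is the unique neighbour in its colour, so N! injects into the singleton colours
  length-N!≤#singletons : length N! ≤ ∑ C (λ i → ind (d i ≡ᵇ 1))
  length-N!≤#singletons = begin
    length N!
      ≡⟨ length-filterᵇ (isN! G v) V ⟩
    ∑ V (λ w → ind (isN! G v w))
      ≤⟨ ∑-mono-≤ V _ _ (λ w _ → isN!≤ w) ⟩
    ∑ V (λ w → ∑ C (λ i → ind (adj G v w ∧ (col G v w ≡ᵇ i)) * ind (d i ≡ᵇ 1)))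
      ≡⟨ ∑-swap V C _ ⟩
    ∑ C (λ i → ∑ V (λ w → ind (adj G v w ∧ (col G v w ≡ᵇ i)) * ind (d i ≡ᵇ 1)))
      ≡⟨ ∑-cong C _ _ (λ i → trans (∑-*ʳ V _ _) (cong (_* ind (d i ≡ᵇ 1)) (sym (countV≡∑ G _)))) ⟩
    ∑ C (λ i → d i * ind (d i ≡ᵇ 1))
      ≤⟨ ∑-mono-≤ C _ _ (λ i _ → x*ind[x≡ᵇ1]≤ind[x≡ᵇ1] (d i)) ⟩
    ∑ C (λ i → ind (d i ≡ᵇ 1)) ∎
    where
    open ≤-Reasoning
    isN!≤ : ∀ w → ind (isN! G v w) ≤ ∑ C (λ i → ind (adj G v w ∧ (col G v w ≡ᵇ i)) * ind (d i ≡ᵇ 1))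
    isN!≤ w with adj G v w in vw
    ... | false = z≤n
    ... | true  = subst (_≤ ∑ C (λ i → ind (col G v w ≡ᵇ i) * ind (d i ≡ᵇ 1)))
                        (trans (cong (λ b → ind b * ind (d (col G v w) ≡ᵇ 1)) (≡ᵇ-refl (col G v w)))
                               (+-identityʳ _))
                        (term≤∑ C _ (col G v w) (col∈colorsAt G vw))
    x*ind[x≡ᵇ1]≤ind[x≡ᵇ1] : ∀ x → x * ind (x ≡ᵇ 1) ≤ ind (x ≡ᵇ 1)
    x*ind[x≡ᵇ1]≤ind[x≡ᵇ1] zero          = z≤n
    x*ind[x≡ᵇ1]≤ind[x≡ᵇ1] (suc zero)    = ≤-refl
    x*ind[x≡ᵇ1]≤ind[x≡ᵇ1] (suc (suc x)) = ≤-reflexive (*-zeroʳ (suc (suc x)))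

  ∑N!D≤∑charge : ∑ N! (λ _ → D) ≤ ∑ C charge
  ∑N!D≤∑charge = begin
    ∑ N! (λ _ → D)                    ≡⟨ ∑-const N! D ⟩
    length N! * D                     ≤⟨ *-monoˡ-≤ D length-N!≤#singletons ⟩
    ∑ C (λ i → ind (d i ≡ᵇ 1)) * D    ≡⟨ ∑-*ʳ C _ D ⟨
    ∑ C charge                        ∎
    where open ≤-Reasoning

  ∑S≤∑charge : ∑ C S ≤ ∑ C charge
  ∑S≤∑charge = begin
    ∑ C S            ≡⟨ ∑S≡∑e ⟩
    ∑ N! e           ≤⟨ ∑-mono-≤ N! e (λ _ → D) (λ y y∈ → e≤D (∈N!⇒adj y∈)) ⟩
    ∑ N! (λ _ → D)   ≤⟨ ∑N!D≤∑charge ⟩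
    ∑ C charge       ∎
    where open ≤-Reasoning

  Q+charge≤P : ∀ i → i ∈ C → Q i + charge i ≤ P i
  Q+charge≤P i i∈ with d i ≡ᵇ 1 in di≡ᵇ1
  ... | true  = subst (λ b → Q i + ind b * D ≤ P i) di≡ᵇ1 (singleton (d i) (≡ᵇ≡true⇒≡ di≡ᵇ1))
    where
    singleton : ∀ x → x ≡ 1 → x * (x ∸ 1) + ind (x ≡ᵇ 1) * D ≤ x * excess
    singleton .1 refl rewrite +-identityʳ D | +-identityʳ excess = max∸1≤∑∸1 C d
  ... | false rewrite +-identityʳ (Q i) = *-monoʳ-≤ (d i) (term≤∑ C (λ j → d j ∸ 1) i i∈)

  ∑Q+∑charge≤∑P : ∑ C Q + ∑ C charge ≤ ∑ C P
  ∑Q+∑charge≤∑P = subst (_≤ ∑ C P) (∑-+ C Q charge) (∑-mono-≤ C _ _ Q+charge≤P)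

  ∑Q+∑S≤∑P : ∑ C Q + ∑ C S ≤ ∑ C P
  ∑Q+∑S≤∑P = ≤-trans (+-monoʳ-≤ (∑ C Q) ∑S≤∑charge) ∑Q+∑charge≤∑P

  0≤B : + 0 ℤ.≤ B G v
  0≤B = subst (+ 0 ℤ.≤_) (sym B≡P-Q-S) (a+b≤c⇒0≤c-a-b (∑ C Q) (∑ C S) (∑ C P) ∑Q+∑S≤∑P)

-- The equality case B(v) = 0

module Tight {n : ℕ} (G : ECGraph n) (v : Fin n) (v-max : dmon G v ≡ Δmon G)
             (2≤Δ : 2 ≤ Δmon G) (B≡0 : B G v ≡ + 0)
             (α : ℕ) (α-max : dcol G v α ≡ dmon G v) where

  open Charging G v v-max

  ∑Q+∑S≡∑P : ∑ C Q + ∑ C S ≡ ∑ C P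
  ∑Q+∑S≡∑P = c-a-b≡0⇒a+b≡c (∑ C Q) (∑ C S) (∑ C P) (trans (sym B≡P-Q-S) B≡0)

  e≡D : ∀ y → y ∈ N! → e y ≡ D
  e≡D = ∑-mono-≤-tight N! e (λ _ → D) (λ y y∈ → e≤D (∈N!⇒adj y∈)) (begin
    ∑ N! (λ _ → D)  ≤⟨ ∑N!D≤∑charge ⟩
    ∑ C charge      ≤⟨ +-cancelˡ-≤ (∑ C Q) _ _
                         (subst (∑ C Q + ∑ C charge ≤_) (sym ∑Q+∑S≡∑P) ∑Q+∑charge≤∑P) ⟩
    ∑ C S           ≡⟨ ∑S≡∑e ⟩
    ∑ N! e          ∎)
    where open ≤-Reasoning

  Q+charge≡P : ∀ i → i ∈ C → Q i + charge i ≡ P i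
  Q+charge≡P = ∑-mono-≤-tight C (λ i → Q i + charge i) P Q+charge≤P (begin
    ∑ C P                             ≡⟨ ∑Q+∑S≡∑P ⟨
    ∑ C Q + ∑ C S                     ≤⟨ +-monoʳ-≤ (∑ C Q) ∑S≤∑charge ⟩
    ∑ C Q + ∑ C charge                ≡⟨ ∑-+ C Q charge ⟨
    ∑ C (λ i → Q i + charge i)        ∎)
    where open ≤-Reasoning

  2≤dα : 2 ≤ d α
  2≤dα = subst (2 ≤_) (sym (trans α-max v-max)) 2≤Δ

  α∈C : α ∈ C
  α∈C = 1≤dcol⇒∈colorsAt G (≤-trans (s≤s z≤n) 2≤dα)

  excess≡dα∸1 : excess ≡ d α ∸ 1
  excess≡dα∸1 = cancel (d α) 2≤dα (Q+charge≡P α α∈C)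
    where
    cancel : ∀ x → 2 ≤ x → x * (x ∸ 1) + ind (x ≡ᵇ 1) * D ≡ x * excess → excess ≡ x ∸ 1
    cancel (suc (suc k)) (s≤s (s≤s _)) eq =
      sym (*-cancelˡ-≡ (suc k) excess (suc (suc k)) (trans (sym (+-identityʳ _)) eq))

  -- α alone uses up the whole excess
  other-colours-singleton : ∀ j → j ∈ C → j ≢ α → d j ≤ 1
  other-colours-singleton j j∈ j≢α = m∸n≡0⇒m≤n (n≤0⇒n≡0 (+-cancelˡ-≤ (d α ∸ 1) _ 0 (begin
    (d α ∸ 1) + (d j ∸ 1)   ≤⟨ two-terms≤∑ C (colorsAt-unique G v) (λ i → d i ∸ 1)
                                            α j α∈C j∈ (j≢α ∘ sym) ⟩
    excess                  ≡⟨ excess≡dα∸1 ⟩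
    d α ∸ 1                 ≡⟨ +-identityʳ _ ⟨
    (d α ∸ 1) + 0           ∎)))
    where open ≤-Reasoning

  N!-is-N-minus-Nα : ∀ y → (InN! G v y → InN G v y × col G v y ≢ α)
                         × (InN G v y × col G v y ≢ α → InN! G v y)
  N!-is-N-minus-Nα y = to , from
    where
    to : InN! G v y → InN G v y × col G v y ≢ α
    to (vy , dy≡1) = vy , λ y-col≡α →
      1+n≰n (≤-trans 2≤dα (≤-reflexive (trans (cong d (sym y-col≡α)) dy≡1)))
    from : InN G v y × col G v y ≢ α → InN! G v y
    from (vy , y-col≢α) =
      vy , ≤-antisym (other-colours-singleton _ (col∈colorsAt G vy) y-col≢α) (adj⇒1≤dcol G vy)

  N!-dmon≡Δmon : ∀ u → InN! G v u → dmon G u ≡ Δmon G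
  N!-dmon≡Δmon u u∈N! = ≤-antisym (dmon≤Δmon G u) (subst (_≤ dmon G u) v-max (begin
    dmon G v                    ≡⟨ suc-pred (dmon G v) {{>-nonZero 0<dmon}} ⟨
    suc D                       ≡⟨ cong suc (e≡D u (InN!⇒∈N! u∈N!)) ⟨
    suc (e u)                   ≤⟨ e<dcol vu ⟩
    dcol G u (col G v u)        ≤⟨ dcol-col-flip≤dmon G vu ⟩
    dmon G u                    ∎))
    where
    open ≤-Reasoning
    vu = proj₁ u∈N!
    0<dmon : 0 < dmon G v
    0<dmon = subst (0 <_) α-max (≤-trans (s≤s z≤n) 2≤dα)

  Sα≡0 : Bi G v α ≡ + 0 → S α ≡ 0
  Sα≡0 Bα≡0 = +-cancelˡ-≡ (Q α) (S α) 0 (begin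
    Q α + S α   ≡⟨ c-a-b≡0⇒a+b≡c (Q α) (S α) (P α) Bα≡0 ⟩
    P α         ≡⟨ cong (d α *_) excess≡dα∸1 ⟩
    Q α         ≡⟨ +-identityʳ _ ⟨
    Q α + 0     ∎)
    where open ≡-Reasoning

  Nα-N!-edges-rainbow : EdgeMinimal G → Bi G v α ≡ + 0 →
    ∀ x y → InNα G α v x → InN! G v y → adj G x y ≡ true → InRE G v x y
  Nα-N!-edges-rainbow minimal Bα≡0 x y (vx , x-col) y∈N! xy = vx , vy , xy , vx≢vy , vx≢xy , vy≢xy
    where
    vy = proj₁ y∈N!
    vx≢vy : col G v x ≢ col G v y
    vx≢vy eq = proj₂ (proj₁ (N!-is-N-minus-Nα y) y∈N!) (trans (sym eq) x-col)
    vy≢xy : col G v y ≢ col G x y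
    vy≢xy eq = 1+n≰n (subst (1 ≤_) (∑≡0⇒term≡0 N! _ (Sα≡0 Bα≡0) y (InN!⇒∈N! y∈N!))
                            (countV-witness G _ yx-counted))
      where
      yx = adj-flip G xy
      yx-counted : (adj G y x ∧ (col G y x ≡ᵇ col G v y) ∧ adj G v x ∧ (col G v x ≡ᵇ α)) ≡ true
      yx-counted
        rewrite yx | col-sym G y x yx | sym eq | ≡ᵇ-refl (col G v y) | vx | x-col | ≡ᵇ-refl α = refl
    vx≢xy : col G v x ≢ col G x y
    vx≢xy eq with minimal v x vx
    ... | inj₁ drops-at-v with 2≤dcol⇒another-edge G 2≤dα x
    ...   | x′ , x′≢x , vx′ , x′-col =
      <⇒≱ drops-at-v (dc≤dc-removeEdge G (inj₁ (refl , refl)) vx′ x′≢x (trans x′-col (sym x-col)))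
    vx≢xy eq | inj₂ drops-at-x =
      <⇒≱ drops-at-x (dc≤dc-removeEdge G (inj₂ (refl , refl)) xy (adj⇒≢ G vy)
                                       (trans (sym eq) (col-sym G v x vx)))

lemma2 : ∀ (n : ℕ) (G : ECGraph n) → EdgeMinimal G →
    ∀ (v : Fin n) → dmon G v ≡ Δmon G →
    ((+ 0) ℤ.≤ B G v)
    × (2 ≤ Δmon G → B G v ≡ + 0 →
       ∀ (α₁ : ℕ) → dcol G v α₁ ≡ dmon G v →
         (∀ y → (InN! G v y → InN G v y × col G v y ≢ α₁)
               × (InN G v y × col G v y ≢ α₁ → InN! G v y))
       × (∀ u → InN! G v u → dmon G u ≡ Δmon G)
       × (Bi G v α₁ ≡ + 0 →
            ∀ x y → InNα G α₁ v x → InN! G v y → adj G x y ≡ true → InRE G v x y))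
lemma2 n G minimal v v-max = Charging.0≤B G v v-max , λ 2≤Δ B≡0 α α-max →
  let open Tight G v v-max 2≤Δ B≡0 α α-max
  in N!-is-N-minus-Nα , N!-dmon≡Δmon , Nα-N!-edges-rainbow minimal
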